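{- Let $G$ be the $d$-dimensional grid graph with side lengths $(n_1,\dots,n_d)$, and let $N_\Sigma=\sum_{i=1}^d n_i$ and $N_\Pi=\prod_{i=1}^d n_i$. Then $$\beta(G)\ge \frac{\log(N_\Pi)}{\log(N_\Sigma-d+1)}.$$
   Context: The $d$-dimensional grid graph with side lengths $(n_1,\dots,n_d)$ is the Cartesian product of paths on $n_1,\dots,n_d$ vertices: its vertices are the integer vectors $(x^{(1)},\dots,x^{(d)})$ with $1\le x^{(i)}\le n_i$, two vertices being adjacent iff they differ by exactly $1$ in exactly one coordinate; thus the distance is $\sum_i |x_A^{(i)}-x_B^{(i)}|$. For a connected graph $H$, a set $R$ of vertices is resolving if every pair of distinct vertices $A\ne B$ has some $X\in R$ with $d_H(A,X)\ne d_H(B,X)$; the metric dimension $\beta(H)$ is the minimum size of a resolving set. -}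

module Defs where

open import Data.Nat using (ℕ; zero; suc; _+_; _*_; _∸_; _^_; _≤_; ∣_-_∣)
open import Data.Fin using (Fin; toℕ) renaming (zero to fz; suc to fs)
open import Data.List using (List; length)
open import Data.List.Relation.Unary.Any using (Any)
open import Data.List.Relation.Unary.AllPairs using (AllPairs)
open import Data.Product using (∃; _×_)
open import Relation.Binary.PropositionalEquality using (_≡_; _≢_)

sumFin : (d : ℕ) → (Fin d → ℕ) → ℕ
sumFin zero    f = 0
sumFin (suc d) f = f fz + sumFin d (λ i → f (fs i))

prodFin : (d : ℕ) → (Fin d → ℕ) → ℕ
prodFin zero    f = 1
prodFin (suc d) f = f fz * prodFin d (λ i → f (fs i))

-- Vertices of the grid with side lengths n : coordinate i ranges over
-- Fin (n i), i.e. {0,…,n i - 1} (a shift of {1,…,n i}).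
Vertex : (d : ℕ) → (Fin d → ℕ) → Set
Vertex d n = (i : Fin d) → Fin (n i)

-- Shortest-path distance in the grid (sum of coordinate differences).
dist : {d : ℕ} {n : Fin d → ℕ} → Vertex d n → Vertex d n → ℕ
dist {d} A B = sumFin d (λ i → ∣ toℕ (A i) - toℕ (B i) ∣)

Distinct : {d : ℕ} {n : Fin d → ℕ} → Vertex d n → Vertex d n → Set
Distinct A B = ∃ λ i → A i ≢ B i

Resolving : {d : ℕ} {n : Fin d → ℕ} → List (Vertex d n) → Set
Resolving {d} {n} R =
  (A B : Vertex d n) → Distinct A B → Any (λ X → dist A X ≢ dist B X) R

-- A finite vertex set, represented as a duplicate-free list.
IsSet : {d : ℕ} {n : Fin d → ℕ} → List (Vertex d n) → Set
IsSet R = AllPairs Distinct R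

IsMetricDimension : (d : ℕ) (n : Fin d → ℕ) → ℕ → Set
IsMetricDimension d n k =
  (∃ λ (R : List (Vertex d n)) → IsSet R × Resolving R × length R ≡ k)
  × ((R : List (Vertex d n)) → IsSet R → Resolving R → k ≤ length R)

-- Read every vertex as a mixed-radix numeral: this embeds Fin (n₁ ⋯ n_d) into the
-- vertex set. A resolving set R of size β embeds the vertices in turn into
-- the tuples of distances to the points of R, and every such distance lies in
-- {0, …, Σ(nᵢ - 1)} = {0, …, N_Σ - d}. Counting gives N_Π ≤ (N_Σ - d + 1)^β.
module Submission where

open import Defs
open import Data.Nat using (ℕ; _+_; _∸_; _^_; _≤_)
open import Data.Fin using (Fin)

open import Data.Nat using (zero; suc; _<_; ∣_-_∣; s≤s; z≤n)
open import Data.Nat.Properties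
  using (≤-trans; ∣m-n∣≤m⊔n; ⊔-lub; ∸-monoˡ-≤; +-mono-≤; +-comm; +-suc; +-assoc; m+[n∸m]≡n; m+n∸n≡m)
open import Data.Fin using (toℕ; fromℕ<; combine; remQuot) renaming (zero to fz; suc to fs)
open import Data.Fin.Properties
  using (toℕ<n; toℕ-fromℕ<; combine-injective; combine-remQuot; injective⇒≤; ¬∀⟶∃¬)
  renaming (_≟_ to _≟ᶠ_)
open import Data.List using (List; []; _∷_; length)
open import Data.List.Relation.Unary.All as All using (All; []; _∷_)
open import Data.Product using (_,_; proj₁; proj₂)
open import Relation.Binary.PropositionalEquality
open import Relation.Nullary using (yes; no)
open import Data.Empty using (⊥-elim)
open import Function using (_∘′_)

private
  variable
    d : ℕ
    n : Fin d → ℕ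

tail : (Fin (suc d) → ℕ) → Fin d → ℕ
tail n i = n (fs i)

toVertex : (d : ℕ) (n : Fin d → ℕ) → Fin (prodFin d n) → Vertex d n
toVertex (suc d) n x fz     = proj₁ (remQuot {n fz} (prodFin d (tail n)) x)
toVertex (suc d) n x (fs i) = toVertex d (tail n) (proj₂ (remQuot {n fz} (prodFin d (tail n)) x)) i

toVertex-injective : (d : ℕ) (n : Fin d → ℕ) (x y : Fin (prodFin d n)) →
  (∀ i → toVertex d n x i ≡ toVertex d n y i) → x ≡ y
toVertex-injective zero    n fz fz _ = refl
toVertex-injective (suc d) n x  y  x≈y = begin
  x                              ≡⟨ sym (combine-remQuot {n fz} k x) ⟩
  combine (proj₁ qx) (proj₂ qx)  ≡⟨ cong₂ combine (x≈y fz) rest≡ ⟩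
  combine (proj₁ qy) (proj₂ qy)  ≡⟨ combine-remQuot {n fz} k y ⟩
  y                              ∎
  where
  open ≡-Reasoning
  k  = prodFin d (tail n)
  qx = remQuot {n fz} k x
  qy = remQuot {n fz} k y
  rest≡ = toVertex-injective d (tail n) (proj₂ qx) (proj₂ qy) (λ i → x≈y (fs i))

toVertex-distinct : (d : ℕ) (n : Fin d → ℕ) {x y : Fin (prodFin d n)} → x ≢ y →
  Distinct (toVertex d n x) (toVertex d n y)
toVertex-distinct d n {x} {y} x≢y =
  ¬∀⟶∃¬ d _ (λ i → toVertex d n x i ≟ᶠ toVertex d n y i) (x≢y ∘′ toVertex-injective d n x y)

sumFin-mono : (f g : Fin d → ℕ) → (∀ i → f i ≤ g i) → sumFin d f ≤ sumFin d g
sumFin-mono {zero}  f g f≤g = z≤n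
sumFin-mono {suc d} f g f≤g = +-mono-≤ (f≤g fz) (sumFin-mono _ _ (λ i → f≤g (fs i)))

sumFin-∸1 : (∀ i → 1 ≤ n i) → sumFin d (λ i → n i ∸ 1) + d ≡ sumFin d n
sumFin-∸1 {zero}      _  = refl
sumFin-∸1 {suc d} {n} 1≤n = begin
  n fz ∸ 1 + s + suc d                ≡⟨ +-suc _ d ⟩
  suc (n fz ∸ 1 + s + d)              ≡⟨ cong suc (+-assoc (n fz ∸ 1) s d) ⟩
  suc (n fz ∸ 1 + (s + d))            ≡⟨ cong (λ t → suc (n fz ∸ 1 + t)) (sumFin-∸1 (λ i → 1≤n (fs i))) ⟩
  suc (n fz ∸ 1) + sumFin d (tail n)  ≡⟨ cong (_+ sumFin d (tail n)) (m+[n∸m]≡n (1≤n fz)) ⟩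
  n fz + sumFin d (tail n)            ∎
  where
  open ≡-Reasoning
  s = sumFin d (λ i → tail n i ∸ 1)

∣toℕ-toℕ∣≤∸1 : {m : ℕ} (a b : Fin m) → ∣ toℕ a - toℕ b ∣ ≤ m ∸ 1
∣toℕ-toℕ∣≤∸1 {m} a b =
  ≤-trans (∣m-n∣≤m⊔n (toℕ a) (toℕ b)) (⊔-lub (toℕ≤m∸1 a) (toℕ≤m∸1 b))
  where
  toℕ≤m∸1 : (c : Fin m) → toℕ c ≤ m ∸ 1
  toℕ≤m∸1 c = ∸-monoˡ-≤ 1 (toℕ<n c)

dist≤ : (A B : Vertex d n) → dist A B ≤ sumFin d (λ i → n i ∸ 1)
dist≤ A B = sumFin-mono _ _ (λ i → ∣toℕ-toℕ∣≤∸1 (A i) (B i))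

dist<diameter+1 : (∀ i → 1 ≤ n i) → (A B : Vertex d n) → dist A B < sumFin d n ∸ d + 1
dist<diameter+1 {d} {n} 1≤n A B =
  subst (dist A B <_) (+-comm 1 _) (s≤s (subst (dist A B ≤_) diameter≡ (dist≤ A B)))
  where
  diameter≡ : sumFin d (λ i → n i ∸ 1) ≡ sumFin d n ∸ d
  diameter≡ = trans (sym (m+n∸n≡m _ d)) (cong (_∸ d) (sumFin-∸1 1≤n))

tupleCode : {A : Set} {m : ℕ} → (A → Fin m) → (xs : List A) → Fin (m ^ length xs)
tupleCode f []       = fz
tupleCode f (x ∷ xs) = combine (f x) (tupleCode f xs)

tupleCode-injective : {A : Set} {m : ℕ} (f g : A → Fin m) (xs : List A) →
  tupleCode f xs ≡ tupleCode g xs → All (λ x → f x ≡ g x) xs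
tupleCode-injective f g []       _  = []
tupleCode-injective f g (x ∷ xs) eq = proj₁ heads≡ ∷ tupleCode-injective f g xs (proj₂ heads≡)
  where heads≡ = combine-injective (f x) (tupleCode f xs) (g x) (tupleCode g xs) eq

module _ {d : ℕ} {n : Fin d → ℕ} (1≤n : ∀ i → 1 ≤ n i) where

  distanceProfile : (R : List (Vertex d n)) → Vertex d n →
                    Fin ((sumFin d n ∸ d + 1) ^ length R)
  distanceProfile R A = tupleCode (λ X → fromℕ< (dist<diameter+1 1≤n A X)) R

  distanceProfile-≡⇒dist≡ : (R : List (Vertex d n)) (A B : Vertex d n) →
    distanceProfile R A ≡ distanceProfile R B → All (λ X → dist A X ≡ dist B X) R
  distanceProfile-≡⇒dist≡ R A B eq = All.map dist≡ (tupleCode-injective _ _ R eq)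
    where
    dist≡ : ∀ {X} → fromℕ< (dist<diameter+1 1≤n A X) ≡ fromℕ< (dist<diameter+1 1≤n B X) →
            dist A X ≡ dist B X
    dist≡ e = trans (sym (toℕ-fromℕ< _)) (trans (cong toℕ e) (toℕ-fromℕ< _))

lemma2 : (d : ℕ) (n : Fin d → ℕ) → (∀ i → 1 ≤ n i) →
    (β : ℕ) → IsMetricDimension d n β →
    prodFin d n ≤ (sumFin d n ∸ d + 1) ^ β
lemma2 d n 1≤n β ((R , _ , resolving , refl) , _) = injective⇒≤ code-injective
  where
  code : Fin (prodFin d n) → Fin ((sumFin d n ∸ d + 1) ^ length R)
  code x = distanceProfile 1≤n R (toVertex d n x)
  code-injective : ∀ {x y} → code x ≡ code y → x ≡ y
  code-injective {x} {y} eq with x ≟ᶠ y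
  ... | yes x≡y = x≡y
  ... | no  x≢y = ⊥-elim (All.lookupWith (λ same differ → differ same)
          (distanceProfile-≡⇒dist≡ 1≤n R (toVertex d n x) (toVertex d n y) eq)
          (resolving _ _ (toVertex-distinct d n x≢y)))
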